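{- Let $B$ be a unital algebra over a field of characteristic zero, $f\in I\cdot\mathrm{Mult}[[B]]$, $k\ge1$, $\tau\in Y_k$, and $\sigma_1,\dots,\sigma_k\in Y$. Let $n=\sum_{i=1}^k(|\sigma_i|+1)$. Then for all $x_1,\dots,x_n\in B$, $$f_{\mu_\tau(\sigma_1\vee|,\dots,\sigma_k\vee|)}(x_1,\dots,x_n)=f_\tau\big(f_{\sigma_1}(x_1,\dots,x_{|\sigma_1|})x_{|\sigma_1|+1},\ \dots,\ f_{\sigma_k}(x_{n-|\sigma_k|},\dots,x_{n-1})x_n\big),$$ where the $i$-th argument is $f_{\sigma_i}$ applied to the next $|\sigma_i|$ variables, times the following variable.
   Context: $\mathrm{Mult}[[B]]$: sequences $f=(f_n)_{n\ge0}$ with $f_n:B^n\to B$ multilinear; $(f\cdot g)_n(x_1,\dots,x_n)=\sum_{k}f_k(x_1,\dots,x_k)g_{n-k}(x_{k+1},\dots,x_n)$; $I_1=\mathrm{Id}_B$, $I_n=0$ otherwise; so $f\in I\cdot\mathrm{Mult}[[B]]$ means $f_0=0$ and $f_n(x_1,\dots,x_n)=x_1F_{n-1}(x_2,\dots,x_n)$ for some $F\in\mathrm{Mult}[[B]]$. Trees: $Y_0=\{|\}$, $Y_n=\{\sigma\vee\tau:\sigma\in Y_k,\tau\in Y_l,k+l=n-1\}$ ($\sigma\vee\tau$: root with left subtree $\sigma$, right subtree $\tau$; $|\tau|$ = number of internal vertices). Each $\tau\in Y_n$, $n\ge1$, is uniquely $\tau_1\vee(\tau_2\vee(\cdots\vee(\tau_k\vee|)))$,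 and $j_i:=|\tau_1|+\dots+|\tau_i|+i$. Define $f_|=1$, $f_\tau(x_1,\dots,x_n)=f_k(f_{\tau_1}(x_1,\dots,x_{j_1-1})x_{j_1},\dots,f_{\tau_k}(x_{j_{k-1}+1},\dots,x_{j_k-1})x_{j_k})$. Grafting: $\alpha/\beta$ attaches $\alpha$ as left subtree of the leftmost internal vertex of $\beta$; $\alpha\backslash\beta$ attaches $\beta$ as right subtree of the rightmost internal vertex of $\alpha$; if one tree is $|$ the result is the other. Substitution: for $\tau\in Y_k$ and nonempty trees $\rho_1,\dots,\rho_k$, $\mu_\tau(\rho_1,\dots,\rho_k)$ replaces the $i$-th vertex of $\tau$ (in left-to-right in-order) by $\rho_i$; recursively $\mu_|()=|$ and, for $\tau=\tau_L\vee\tau_R$ with $|\tau_L|=j-1$, $\mu_\tau(\rho_1,\dots,\rho_k)=\big(\mu_{\tau_L}(\rho_1,\dots,\rho_{j-1})/\rho_j\big)\backslash\mu_{\tau_R}(\rho_{j+1},\dots,\rho_k)$. -}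

module Defs where

open import Level using (Level; _⊔_) renaming (suc to lsuc)
import Data.Nat as ℕ
open ℕ using (ℕ; zero; suc)
open import Data.Fin using (Fin)
open import Data.Vec using (Vec; []; _∷_; take; drop; _[_]≔_)
open import Data.Vec.Relation.Binary.Pointwise.Inductive using (Pointwise)
open import Algebra.Bundles using (CommutativeRing; Ring)
open import Relation.Nullary using (¬_)
open import Data.Product using (Σ; _×_; _,_)

module _ {c ℓ} (K : CommutativeRing c ℓ) where
  open CommutativeRing K

  natToK : ℕ → Carrier
  natToK zero = 0#
  natToK (suc n) = 1# + natToK n

  record IsField : Set (c ⊔ ℓ) where
    field
      0≉1 : ¬ (0# ≈ 1#)
      inverse : ∀ x → ¬ (x ≈ 0#) → Σ Carrier λ y → (x * y) ≈ 1#

  CharZero : Set ℓ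
  CharZero = ∀ n → ¬ (natToK (suc n) ≈ 0#)

record UnitalAlgebra {c ℓ} (K : CommutativeRing c ℓ) b bℓ : Set (c ⊔ ℓ ⊔ lsuc (b ⊔ bℓ)) where
  private module K = CommutativeRing K
  field
    ring : Ring b bℓ
  open Ring ring public
  infixr 7 _·_
  field
    _·_      : K.Carrier → Carrier → Carrier
    ·-cong   : ∀ {a a' x x'} → a K.≈ a' → x ≈ x' → (a · x) ≈ (a' · x')
    ·-distribˡ : ∀ a x y → (a · (x + y)) ≈ ((a · x) + (a · y))
    ·-distribʳ : ∀ a a' x → ((a K.+ a') · x) ≈ ((a · x) + (a' · x))
    ·-assoc  : ∀ a a' x → ((a K.* a') · x) ≈ (a · (a' · x))
    ·-identity : ∀ x → (K.1# · x) ≈ x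
    ·-*-assocˡ : ∀ a x y → (a · (x * y)) ≈ ((a · x) * y)
    ·-*-assocʳ : ∀ a x y → (a · (x * y)) ≈ (x * (a · y))

module _ {c ℓ b bℓ} {K : CommutativeRing c ℓ} (B : UnitalAlgebra K b bℓ) where
  open UnitalAlgebra B

  record IsMultilinear {n : ℕ} (g : Vec Carrier n → Carrier) : Set (c ⊔ b ⊔ bℓ) where
    field
      cong     : ∀ {xs ys} → Pointwise _≈_ xs ys → g xs ≈ g ys
      additive : ∀ (i : Fin n) xs x y →
                 g (xs [ i ]≔ (x + y)) ≈ (g (xs [ i ]≔ x) + g (xs [ i ]≔ y))
      homogeneous : ∀ (i : Fin n) xs (a : CommutativeRing.Carrier K) x →
                 g (xs [ i ]≔ (a · x)) ≈ (a · g (xs [ i ]≔ x))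

  -- underlying data of an element of Mult[[B]]
  MultSeq : Set b
  MultSeq = (n : ℕ) → Vec Carrier n → Carrier

  IsMult : MultSeq → Set (c ⊔ b ⊔ bℓ)
  IsMult f = ∀ n → IsMultilinear (f n)

  -- f ∈ I · Mult[[B]]: f_0 = 0 and f_{n+1}(x₁,…) = x₁ F_n(x₂,…) for some F ∈ Mult[[B]]
  InIMult : MultSeq → Set (c ⊔ b ⊔ bℓ)
  InIMult f = IsMult f × (f 0 [] ≈ 0#) ×
              Σ MultSeq λ F → IsMult F ×
                (∀ n x (xs : Vec Carrier n) → f (suc n) (x ∷ xs) ≈ (x * F n xs))

data Tree : Set where
  leaf : Tree
  _∨_  : Tree → Tree → Tree

infixr 5 _∨_

-- number of internal vertices; arranged so that the vertices in in-order
-- are: those of the left subtree, the root, those of the right subtree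
size : Tree → ℕ
size leaf = 0
size (l ∨ r) = size l ℕ.+ suc (size r)

_/_ : Tree → Tree → Tree
α / leaf = α
α / (l ∨ r) = (α / l) ∨ r

_\\_ : Tree → Tree → Tree
leaf \\ β = β
(l ∨ r) \\ β = l ∨ (r \\ β)

μ : (τ : Tree) → Vec Tree (size τ) → Tree
μ leaf [] = leaf
μ (l ∨ r) ρs with drop (size l) ρs
... | ρ ∷ ρR = (μ l (take (size l) ρs) / ρ) \\ μ r ρR

spine : Tree → ℕ
spine leaf = 0
spine (l ∨ r) = suc (spine r)

total : ∀ {k} → Vec Tree k → ℕ
total [] = 0
total (σ ∷ σs) = size σ ℕ.+ suc (total σs)

module _ {c ℓ b bℓ} {K : CommutativeRing c ℓ} (B : UnitalAlgebra K b bℓ) where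
  open UnitalAlgebra B

  mutual
    fT : MultSeq B → (τ : Tree) → Vec Carrier (size τ) → Carrier
    fT f leaf [] = 1#
    fT f (l ∨ r) xs = f (spine (l ∨ r)) (spineArgs f (l ∨ r) xs)

    spineArgs : MultSeq B → (τ : Tree) → Vec Carrier (size τ) → Vec Carrier (spine τ)
    spineArgs f leaf [] = []
    spineArgs f (l ∨ r) xs with drop (size l) xs
    ... | x ∷ rest = (fT f l (take (size l) xs) * x) ∷ spineArgs f r rest

  blockArgs : MultSeq B → ∀ {k} (σs : Vec Tree k) → Vec Carrier (total σs) → Vec Carrier k
  blockArgs f [] [] = []
  blockArgs f (σ ∷ σs) xs with drop (size σ) xs
  ... | x ∷ rest = (fT f σ (take (size σ) xs) * x) ∷ blockArgs f σs rest

{-# OPTIONS --safe #-}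
module Submission where

-- The only property of f that matters is f_{n+1}(x, xs) ≈ x · F_n(xs): it makes grafting
-- multiplicative, f_{α/β}(xs, ys) ≈ f_α(xs) · f_β(ys), because α / β changes only the first spine
-- argument of β, and that argument is a left factor of f_β. For τ = L ∨ R the substituted tree is
-- (μ_L(…) / σ) ∨ μ_R(…), so its first spine argument is f_{μ_L(…)}(…) · f_σ(…) · x, which by induction
-- on L is f_L(block arguments) · (f_σ(…) · x), the first spine argument of f_τ at the block arguments;
-- the remaining spine arguments are those of μ_R(…) and R, equal by induction on R.

open import Defs
open import Data.Nat using (suc; _+_; _≤_)
open import Data.Nat.Properties using (+-assoc; +-identityʳ)
open import Data.Vec using (Vec; []; _∷_; map; take; drop; splitAt; _++_; cast)
open import Data.Vec.Properties
  using (map-++; cast-is-id; cast-trans; cast-sym; cast-++ˡ; cast-++ʳ; ++-assoc-eqFree; ++-identityʳ-eqFree;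
         subst-is-cast)
open import Data.Vec.Relation.Binary.Pointwise.Inductive using (Pointwise; []; _∷_; length-equal)
open import Data.Product using (Σ; ∃₂; _,_)
open import Algebra.Bundles using (CommutativeRing)
open import Relation.Binary.PropositionalEquality
  using (_≡_; refl; sym; trans; cong; cong₂; subst; module ≡-Reasoning)
import Relation.Binary.Reasoning.Setoid as SetoidReasoning

module _ {a} {A : Set a} where

  take-++ : ∀ {m n} (xs : Vec A m) (ys : Vec A n) → take m (xs ++ ys) ≡ xs
  take-++ []       ys = refl
  take-++ (x ∷ xs) ys = cong (x ∷_) (take-++ xs ys)

  drop-++ : ∀ {m n} (xs : Vec A m) (ys : Vec A n) → drop m (xs ++ ys) ≡ ys
  drop-++ []       ys = refl
  drop-++ (x ∷ xs) ys = drop-++ xs ys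

  split-∷ : ∀ m {n} (xs : Vec A (m + suc n)) →
            Σ (Vec A m) λ ys → Σ A λ x → Σ (Vec A n) λ zs → xs ≡ ys ++ x ∷ zs
  split-∷ m xs with splitAt m xs
  ... | ys , x ∷ zs , split = ys , x , zs , split

  splitAt-cast : ∀ m {n o} .(eq : n ≡ m + o) (xs : Vec A n) →
                 ∃₂ λ (ys : Vec A m) (zs : Vec A o) → xs ≡ cast (sym eq) (ys ++ zs)
  splitAt-cast m eq xs with splitAt m (cast eq xs)
  ... | ys , zs , split = ys , zs , sym (cast-sym eq split)

  ++-assocʳ-cast : ∀ {m n o p} .(eq : n + o ≡ p) (xs : Vec A m) (ys : Vec A n) (zs : Vec A o) →
                   cast (trans (+-assoc m n o) (cong (m +_) eq)) ((xs ++ ys) ++ zs)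
                     ≡ xs ++ cast eq (ys ++ zs)
  ++-assocʳ-cast {m} {n} {o} eq xs ys zs = begin
    cast _ ((xs ++ ys) ++ zs)                          ≡⟨ cast-trans (+-assoc m n o) (cong (m +_) eq) _ ⟨
    cast (cong (m +_) eq) (cast _ ((xs ++ ys) ++ zs))  ≡⟨ cong (cast _) (++-assoc-eqFree xs ys zs) ⟩
    cast (cong (m +_) eq) (xs ++ (ys ++ zs))           ≡⟨ cast-++ʳ eq xs ⟩
    xs ++ cast eq (ys ++ zs)                           ∎
    where open ≡-Reasoning

  ++-assocˡ-cast : ∀ {m n o p q} .(eq₁ : m + n ≡ p) .(eq₂ : o ≡ q)
                   (xs : Vec A m) (ys : Vec A n) (zs : Vec A o) →
                   cast (trans (sym (+-assoc m n o)) (cong₂ _+_ eq₁ eq₂)) (xs ++ (ys ++ zs))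
                     ≡ cast eq₁ (xs ++ ys) ++ cast eq₂ zs
  ++-assocˡ-cast {m} {n} {o} {p} eq₁ eq₂ xs ys zs = begin
    cast _ (xs ++ (ys ++ zs))
      ≡⟨ cast-trans (sym (+-assoc m n o)) _ _ ⟨
    cast _ (cast (sym (+-assoc m n o)) (xs ++ (ys ++ zs)))
      ≡⟨ cong (cast _) (cast-sym _ (++-assoc-eqFree xs ys zs)) ⟩
    cast _ ((xs ++ ys) ++ zs)
      ≡⟨ cast-trans (cong (_+ o) eq₁) (cong (p +_) eq₂) _ ⟨
    cast (cong (p +_) eq₂) (cast (cong (_+ o) eq₁) ((xs ++ ys) ++ zs))
      ≡⟨ cong (cast _) (cast-++ˡ eq₁ (xs ++ ys)) ⟩
    cast (cong (p +_) eq₂) (cast eq₁ (xs ++ ys) ++ zs)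
      ≡⟨ cast-++ʳ eq₂ (cast eq₁ (xs ++ ys)) ⟩
    cast eq₁ (xs ++ ys) ++ cast eq₂ zs
      ∎
    where open ≡-Reasoning

  ++-assocˡ-cast₃ : ∀ {m m′ n o p q} .(eq₀ : m ≡ m′) .(eq₁ : m′ + n ≡ p) .(eq₂ : o ≡ q)
                    (xs : Vec A m) (ys : Vec A n) (zs : Vec A o) →
                    cast (trans (sym (+-assoc m n o)) (cong₂ _+_ (trans (cong (_+ n) eq₀) eq₁) eq₂))
                         (xs ++ (ys ++ zs))
                      ≡ cast eq₁ (cast eq₀ xs ++ ys) ++ cast eq₂ zs
  ++-assocˡ-cast₃ {n = n} eq₀ eq₁ eq₂ xs ys zs = begin
    cast _ (xs ++ (ys ++ zs))
      ≡⟨ ++-assocˡ-cast (trans (cong (_+ n) eq₀) eq₁) eq₂ xs ys zs ⟩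
    cast _ (xs ++ ys) ++ cast eq₂ zs
      ≡⟨ cong (_++ cast eq₂ zs) (cast-trans (cong (_+ n) eq₀) eq₁ _) ⟨
    cast eq₁ (cast (cong (_+ n) eq₀) (xs ++ ys)) ++ cast eq₂ zs
      ≡⟨ cong (λ v → cast eq₁ v ++ cast eq₂ zs) (cast-++ˡ eq₀ xs) ⟩
    cast eq₁ (cast eq₀ xs ++ ys) ++ cast eq₂ zs
      ∎
    where open ≡-Reasoning

size-/ : ∀ α β → size (α / β) ≡ size α + size β
size-/ α leaf    = sym (+-identityʳ (size α))
size-/ α (l ∨ r) = trans (cong (_+ suc (size r)) (size-/ α l))
                         (+-assoc (size α) (size l) (suc (size r)))

total-++ : ∀ {m n} (σs : Vec Tree m) (ρs : Vec Tree n) → total (σs ++ ρs) ≡ total σs + total ρs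
total-++ []       ρs = refl
total-++ (σ ∷ σs) ρs = trans (cong (λ t → size σ + suc t) (total-++ σs ρs))
                             (sym (+-assoc (size σ) (suc (total σs)) (total ρs)))

μ-∨ : ∀ l r (ρl : Vec Tree (size l)) ρ ρr → μ (l ∨ r) (ρl ++ ρ ∷ ρr) ≡ (μ l ρl / ρ) \\ μ r ρr
μ-∨ l r ρl ρ ρr rewrite drop-++ ρl (ρ ∷ ρr) | take-++ ρl (ρ ∷ ρr) = refl

μ-∨-∨leaf : ∀ l r (σl : Vec Tree (size l)) σ σr →
            μ (l ∨ r) (map (_∨ leaf) (σl ++ σ ∷ σr))
              ≡ (μ l (map (_∨ leaf) σl) / σ) ∨ μ r (map (_∨ leaf) σr)
μ-∨-∨leaf l r σl σ σr = trans (cong (μ (l ∨ r)) (map-++ (_∨ leaf) σl (σ ∷ σr)))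
                              (μ-∨ l r (map (_∨ leaf) σl) (σ ∨ leaf) (map (_∨ leaf) σr))

size-μ : ∀ τ (σs : Vec Tree (size τ)) → size (μ τ (map (_∨ leaf) σs)) ≡ total σs
size-μ leaf    []  = refl
size-μ (l ∨ r) σs with splitAt (size l) σs
... | σl , σ ∷ σr , refl = begin
  size (μ (l ∨ r) (map (_∨ leaf) (σl ++ σ ∷ σr)))  ≡⟨ cong size (μ-∨-∨leaf l r σl σ σr) ⟩
  size (P / σ) + suc (size M)                      ≡⟨ cong₂ (λ s t → s + suc t) (size-/ P σ) (size-μ r σr) ⟩
  (size P + size σ) + suc (total σr)               ≡⟨ cong (λ s → (s + size σ) + suc (total σr)) (size-μ l σl) ⟩
  (total σl + size σ) + suc (total σr)             ≡⟨ +-assoc (total σl) (size σ) (suc (total σr)) ⟩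
  total σl + total (σ ∷ σr)                        ≡⟨ total-++ σl (σ ∷ σr) ⟨
  total (σl ++ σ ∷ σr)                             ∎
  where
    open ≡-Reasoning
    P = μ l (map (_∨ leaf) σl)
    M = μ r (map (_∨ leaf) σr)

module _ {c ℓ b bℓ} {K : CommutativeRing c ℓ} (B : UnitalAlgebra K b bℓ) (f : MultSeq B) where
  open UnitalAlgebra B using (Carrier; _≈_; _*_; 1#; setoid; *-congˡ; *-congʳ; *-assoc; *-identityʳ)
    renaming (refl to ≈-refl)

  spineArgs-∨ : ∀ l r (xs : Vec Carrier (size l)) x ys →
                spineArgs B f (l ∨ r) (xs ++ x ∷ ys) ≡ (fT B f l xs * x) ∷ spineArgs B f r ys
  spineArgs-∨ l r xs x ys rewrite drop-++ xs (x ∷ ys) | take-++ xs (x ∷ ys) = refl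

  blockArgs-∷ : ∀ {k} σ (σs : Vec Tree k) (xs : Vec Carrier (size σ)) x ys →
                blockArgs B f (σ ∷ σs) (xs ++ x ∷ ys) ≡ (fT B f σ xs * x) ∷ blockArgs B f σs ys
  blockArgs-∷ σ σs xs x ys rewrite drop-++ xs (x ∷ ys) | take-++ xs (x ∷ ys) = refl

  blockArgs-++ : ∀ {m n} (σs : Vec Tree m) (ρs : Vec Tree n) xs ys →
                 blockArgs B f (σs ++ ρs) (cast (sym (total-++ σs ρs)) (xs ++ ys))
                   ≡ blockArgs B f σs xs ++ blockArgs B f ρs ys
  blockArgs-++ []       ρs [] ys = cong (blockArgs B f ρs) (cast-is-id _ ys)
  blockArgs-++ (σ ∷ σs) ρs xs ys with split-∷ (size σ) xs
  ... | ws , x , xs′ , refl = begin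
    blockArgs B f (σ ∷ σs ++ ρs) (cast _ ((ws ++ x ∷ xs′) ++ ys))
      ≡⟨ cong (blockArgs B f (σ ∷ σs ++ ρs))
              (++-assocʳ-cast (cong suc (sym (total-++ σs ρs))) ws (x ∷ xs′) ys) ⟩
    blockArgs B f (σ ∷ σs ++ ρs) (ws ++ x ∷ cast _ (xs′ ++ ys))
      ≡⟨ blockArgs-∷ σ (σs ++ ρs) ws x _ ⟩
    (fT B f σ ws * x) ∷ blockArgs B f (σs ++ ρs) (cast _ (xs′ ++ ys))
      ≡⟨ cong ((fT B f σ ws * x) ∷_) (blockArgs-++ σs ρs xs′ ys) ⟩
    (fT B f σ ws * x) ∷ blockArgs B f σs xs′ ++ blockArgs B f ρs ys
      ≡⟨ cong (_++ blockArgs B f ρs ys) (blockArgs-∷ σ σs ws x xs′) ⟨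
    blockArgs B f (σ ∷ σs) (ws ++ x ∷ xs′) ++ blockArgs B f ρs ys
      ∎
    where open ≡-Reasoning

  module _ (f-resp : ∀ {n} {xs ys : Vec Carrier n} → Pointwise _≈_ xs ys → f n xs ≈ f n ys)
           (F : MultSeq B) (f-factor : ∀ n x xs → f (suc n) (x ∷ xs) ≈ x * F n xs) where

    fT-∨ : ∀ l r (xs : Vec Carrier (size l)) x ys →
           fT B f (l ∨ r) (xs ++ x ∷ ys) ≈ (fT B f l xs * x) * F (spine r) (spineArgs B f r ys)
    fT-∨ l r xs x ys = begin
      f (suc (spine r)) (spineArgs B f (l ∨ r) (xs ++ x ∷ ys))
        ≡⟨ cong (f (suc (spine r))) (spineArgs-∨ l r xs x ys) ⟩
      f (suc (spine r)) ((fT B f l xs * x) ∷ spineArgs B f r ys)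
        ≈⟨ f-factor _ _ _ ⟩
      (fT B f l xs * x) * F (spine r) (spineArgs B f r ys)
        ∎
      where open SetoidReasoning setoid

    fT-/ : ∀ α β (xs : Vec Carrier (size α)) (ys : Vec Carrier (size β)) →
           fT B f (α / β) (cast (sym (size-/ α β)) (xs ++ ys)) ≈ fT B f α xs * fT B f β ys
    fT-/ α leaf    xs [] = begin
      fT B f α (cast _ (xs ++ []))  ≡⟨ cong (fT B f α) (++-identityʳ-eqFree xs) ⟩
      fT B f α xs                   ≈⟨ *-identityʳ _ ⟨
      fT B f α xs * 1#              ∎
      where open SetoidReasoning setoid
    fT-/ α (l ∨ r) xs ys with split-∷ (size l) ys
    ... | ysl , y , ysr , refl = begin
      fT B f ((α / l) ∨ r) (cast _ (xs ++ (ysl ++ y ∷ ysr)))  ≡⟨ cong (fT B f ((α / l) ∨ r)) regroup ⟩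
      fT B f ((α / l) ∨ r) (cast _ (xs ++ ysl) ++ y ∷ ysr)    ≈⟨ fT-∨ (α / l) r _ y ysr ⟩
      (fT B f (α / l) (cast _ (xs ++ ysl)) * y) * Fr          ≈⟨ *-congʳ (*-congʳ (fT-/ α l xs ysl)) ⟩
      ((fT B f α xs * fT B f l ysl) * y) * Fr                 ≈⟨ *-congʳ (*-assoc _ _ _) ⟩
      (fT B f α xs * (fT B f l ysl * y)) * Fr                 ≈⟨ *-assoc _ _ _ ⟩
      fT B f α xs * ((fT B f l ysl * y) * Fr)                 ≈⟨ *-congˡ (fT-∨ l r ysl y ysr) ⟨
      fT B f α xs * fT B f (l ∨ r) (ysl ++ y ∷ ysr)           ∎
      where
        open SetoidReasoning setoid
        Fr = F (spine r) (spineArgs B f r ysr)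
        regroup : cast (sym (size-/ α (l ∨ r))) (xs ++ (ysl ++ y ∷ ysr))
                    ≡ cast (sym (size-/ α l)) (xs ++ ysl) ++ y ∷ ysr
        regroup = trans (++-assocˡ-cast (sym (size-/ α l)) refl xs ysl (y ∷ ysr))
                        (cong (cast (sym (size-/ α l)) (xs ++ ysl) ++_) (cast-is-id refl (y ∷ ysr)))

    f-resp-Pointwise : ∀ {m n} {xs : Vec Carrier m} {ys : Vec Carrier n} →
                       Pointwise _≈_ xs ys → f m xs ≈ f n ys
    f-resp-Pointwise xs≈ys with refl ← length-equal xs≈ys = f-resp xs≈ys

    fT-resp-spineArgs : ∀ t u {xs ys} → Pointwise _≈_ (spineArgs B f t xs) (spineArgs B f u ys) →
                        fT B f t xs ≈ fT B f u ys
    fT-resp-spineArgs leaf    leaf    {[]} {[]} _ = ≈-refl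
    fT-resp-spineArgs leaf    (_ ∨ _) p with () ← length-equal p
    fT-resp-spineArgs (_ ∨ _) leaf    p with () ← length-equal p
    fT-resp-spineArgs (_ ∨ _) (_ ∨ _) p = f-resp-Pointwise p

    spineArgs-μ : ∀ τ (σs : Vec Tree (size τ)) (xs : Vec Carrier (total σs)) →
                  Pointwise _≈_ (spineArgs B f (μ τ (map (_∨ leaf) σs)) (cast (sym (size-μ τ σs)) xs))
                                (spineArgs B f τ (blockArgs B f σs xs))
    spineArgs-μ leaf    []  [] = []
    spineArgs-μ (L ∨ R) σs xs with splitAt (size L) σs
    ... | σL , σ ∷ σR , refl with splitAt-cast (total σL) (total-++ σL (σ ∷ σR)) xs
    ...   | xsL , xsR , refl with split-∷ (size σ) xsR
    ...     | ys , x , zs , refl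
      rewrite blockArgs-++ σL (σ ∷ σR) xsL (ys ++ x ∷ zs)
            | blockArgs-∷ σ σR ys x zs
            | spineArgs-∨ L R (blockArgs B f σL xsL) (fT B f σ ys * x) (blockArgs B f σR zs)
            | μ-∨-∨leaf L R σL σ σR
            = subst (λ as → Pointwise _≈_ as (fT B f L bL * (fT B f σ ys * x) ∷ spineArgs B f R bR))
                    (sym (trans (cong (spineArgs B f ((P / σ) ∨ M)) regroup) (spineArgs-∨ (P / σ) M _ x _)))
                    (head ∷ spineArgs-μ R σR zs)
      where
        P = μ L (map (_∨ leaf) σL)
        M = μ R (map (_∨ leaf) σR)
        bL = blockArgs B f σL xsL
        bR = blockArgs B f σR zs

        -- the cast proof is irrelevant; it only fixes the index left behind by rewriting with μ-∨-∨leaf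
        regroup : cast {n = size ((P / σ) ∨ M)}
                       (trans (sym (size-μ (L ∨ R) (σL ++ σ ∷ σR))) (cong size (μ-∨-∨leaf L R σL σ σR)))
                       (cast (sym (total-++ σL (σ ∷ σR))) (xsL ++ (ys ++ x ∷ zs)))
                    ≡ cast (sym (size-/ P σ)) (cast (sym (size-μ L σL)) xsL ++ ys)
                        ++ x ∷ cast (sym (size-μ R σR)) zs
        regroup = trans (cast-trans (sym (total-++ σL (σ ∷ σR))) _ _)
                        (++-assocˡ-cast₃ (sym (size-μ L σL)) (sym (size-/ P σ)) (cong suc (sym (size-μ R σR)))
                                         xsL ys (x ∷ zs))

        head : fT B f (P / σ) (cast (sym (size-/ P σ)) (cast (sym (size-μ L σL)) xsL ++ ys)) * x
                 ≈ fT B f L bL * (fT B f σ ys * x)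
        head = begin
          fT B f (P / σ) (cast _ (cast _ xsL ++ ys)) * x
            ≈⟨ *-congʳ (fT-/ P σ _ ys) ⟩
          (fT B f P (cast _ xsL) * fT B f σ ys) * x
            ≈⟨ *-congʳ (*-congʳ (fT-resp-spineArgs P L (spineArgs-μ L σL xsL))) ⟩
          (fT B f L bL * fT B f σ ys) * x
            ≈⟨ *-assoc _ _ _ ⟩
          fT B f L bL * (fT B f σ ys * x)
            ∎
          where open SetoidReasoning setoid

    fT-μ : ∀ τ (σs : Vec Tree (size τ)) (xs : Vec Carrier (total σs)) →
           fT B f (μ τ (map (_∨ leaf) σs)) (cast (sym (size-μ τ σs)) xs)
             ≈ fT B f τ (blockArgs B f σs xs)
    fT-μ τ σs xs = fT-resp-spineArgs (μ τ (map (_∨ leaf) σs)) τ (spineArgs-μ τ σs xs)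

lemma3p11 : ∀ {c ℓ b bℓ} (K : CommutativeRing c ℓ) → IsField K → CharZero K →
    (B : UnitalAlgebra K b bℓ) → (f : MultSeq B) → InIMult B f →
    (τ : Tree) → 1 ≤ size τ → (σs : Vec Tree (size τ)) →
    Σ (size (μ τ (map (λ σ → σ ∨ leaf) σs)) ≡ total σs) λ eq →
      ∀ (xs : Vec (UnitalAlgebra.Carrier B) (total σs)) →
        UnitalAlgebra._≈_ B
          (fT B f (μ τ (map (λ σ → σ ∨ leaf) σs)) (subst (Vec (UnitalAlgebra.Carrier B)) (sym eq) xs))
          (fT B f τ (blockArgs B f σs xs))
lemma3p11 K _ _ B f (f-mult , _ , F , _ , f-factor) τ _ σs = size-μ τ σs , λ xs → begin
  fT B f T (subst (Vec Carrier) (sym (size-μ τ σs)) xs)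
    ≡⟨ cong (fT B f T) (subst-is-cast (sym (size-μ τ σs)) xs) ⟩
  fT B f T (cast (sym (size-μ τ σs)) xs)
    ≈⟨ fT-μ B f f-resp F f-factor τ σs xs ⟩
  fT B f τ (blockArgs B f σs xs)
    ∎
  where
    open UnitalAlgebra B using (Carrier; _≈_; setoid)
    open SetoidReasoning setoid
    T = μ τ (map (_∨ leaf) σs)
    f-resp : ∀ {n} {xs ys : Vec Carrier n} → Pointwise _≈_ xs ys → f n xs ≈ f n ys
    f-resp {n} = IsMultilinear.cong (f-mult n)
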